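{- Let $P$ be a program modelled as below and let $k_{max}\ge1$ be an integer. Consider the run of $\mathrm{kind}(P,k_{max},1)$. Then: (i) if it returns a nonempty sequence of states, that sequence is a counterexample (a non-spurious one), so $P$ is unsafe; (ii) if it returns $\emptyset$, then $P$ is safe; (iii) if it returns $\mathit{unknown}$, then $P$ is safe up to $k_{max}$.
   Context: A program $P$ is modelled as a transition system given by a set $S$ of states, a set $\mathit{init}_P\subseteq S$ of initial states, a transition relation $tr_P\subseteq S\times S$, a safety property $\phi\subseteq S$ and a completeness predicate $\psi\subseteq S$. Terminated executions are modelled by stuttering: every state has at least one $tr_P$-successor, and $\psi(s)$ holds iff the only $tr_P$-successor of $s$ is $s$ itself (all loops have been exited). A path is a finite sequence $s_1,\dots,s_m$ ($m\ge1$) of states with $tr_P(s_i,s_{i+1})$ for $1\le i<m$; it is initial if $s_1\in\mathit{init}_P$. A state $s$ with $\neg\phi(s)$ is an error state. A counterexample is an initial path whose last state is an error state; its length is its number of states. $P$ is unsafe if a counterexample exists and safe otherwise; $P$ is safe up to $K$ if it has no counterexample of length at most $K$. $\emptyset$ denotes the empty sequence. Checks for a bound $k\ge1$ (each may return any witness satisfying its condition): - $\mathrm{base\_case}_k(P)$: if there is an initial path $s_1,\dots,s_k$ and an index $1\le i\le k$ with $\neg\phi(s_i)$, return $[s_1,\dots,s_i]$; otherwise return $\emptyset$. - $\mathrm{forward\_condition}_k(P)$: if there is an initial path $s_1,\dots,s_k$ with $\neg\psi(s_k)$, return $[s_1,\dots,s_k]$; otherwise return $\emptyset$. - $\mathrm{inductive\_step}_k(P)$: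 if there are states $t_0,\dots,t_k\in S$ (not necessarily initial or reachable) with $tr_P(t_i,t_{i+1})$ and $\phi(t_i)$ for all $0\le i<k$ and $\neg\phi(t_k)$, return $[t_0,\dots,t_k]$; otherwise return $\emptyset$. Algorithm $\mathrm{kind}(P,k_{max},k)$: if $k>k_{max}$ return $\mathit{unknown}$; let $\pi:=\mathrm{base\_case}_k(P)$, and if $\pi\neq\emptyset$ return $\pi$; let $\pi:=\mathrm{forward\_condition}_k(P)$, and if $\pi=\emptyset$ return $\emptyset$; let $\pi:=\mathrm{inductive\_step}_k(P)$, and if $\pi=\emptyset$ return $\emptyset$; otherwise return $\mathrm{kind}(P,k_{max},k+1)$. -}

module Defs where

open import Data.Nat using (ℕ; zero; suc; _≤_; _<_; _∸_; _+_)
open import Data.List using (List; []; _∷_; length; take; _++_; [_])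
open import Data.List.Relation.Unary.All using (All)
open import Data.List.Relation.Unary.Linked using (Linked)
open import Data.Product using (Σ; ∃; _×_; _,_)
open import Data.Sum using (_⊎_)
open import Relation.Nullary using (¬_)
open import Relation.Binary.PropositionalEquality using (_≡_)

-- A program modelled as a transition system, with the standing
-- stuttering assumptions on termination.
record Program : Set₁ where
  field
    S    : Set
    init : S → Set
    tr   : S → S → Set
    φ    : S → Set
    ψ    : S → Set      -- completeness predicate
    total : ∀ s → ∃ λ s' → tr s s'
    ψ-stutter : ∀ s → (ψ s → tr s s × (∀ s' → tr s s' → s' ≡ s))
                    × ((tr s s × (∀ s' → tr s s' → s' ≡ s)) → ψ s)

module _ (P : Program) where
  open Program P

  Last : (S → Set) → List S → Set
  Last Q []           = ⊥′
    where open import Data.Empty renaming (⊥ to ⊥′)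
  Last Q (x ∷ [])     = Q x
  Last Q (x ∷ y ∷ ys) = Last Q (y ∷ ys)

  First : (S → Set) → List S → Set
  First Q []       = ⊥′
    where open import Data.Empty renaming (⊥ to ⊥′)
  First Q (x ∷ _)  = Q x

  IsPath : List S → Set
  IsPath xs = First (λ _ → ⊤′) xs × Linked tr xs
    where open import Data.Unit renaming (⊤ to ⊤′)

  InitPath : List S → Set
  InitPath xs = IsPath xs × First init xs

  ErrorState : S → Set
  ErrorState s = ¬ φ s

  Counterexample : List S → Set
  Counterexample xs = InitPath xs × Last ErrorState xs

  HasCounterexample : Set
  HasCounterexample = ∃ Counterexample

  IsSafe : Set
  IsSafe = ¬ HasCounterexample

  SafeUpTo : ℕ → Set
  SafeUpTo K = ∀ xs → Counterexample xs → ¬ (length xs ≤ K)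

  BaseWitness : ℕ → List S → Set
  BaseWitness k r = Σ (List S) λ p → InitPath p × length p ≡ k ×
                      Σ ℕ λ i → 1 ≤ i × i ≤ k × r ≡ take i p × Last ErrorState r

  ForwardWitness : ℕ → List S → Set
  ForwardWitness k r = InitPath r × length r ≡ k × Last (λ s → ¬ ψ s) r

  InductiveWitness : ℕ → List S → Set
  InductiveWitness k r = Linked tr r × Σ (List S) λ ts → Σ S λ t →
                           r ≡ ts ++ [ t ] × length ts ≡ k × All φ ts × ¬ φ t

  CheckSpec : (ℕ → List S → Set) → (ℕ → List S) → Set
  CheckSpec W f = ∀ k → 1 ≤ k →
                    (f k ≡ [] × (∀ r → ¬ W k r)) ⊎ W k (f k)

  data Result : Set where
    unknown : Result
    seq     : List S → Result

  -- kind with given implementations of the checks; recursion on fuel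
  -- (kind kmax k = kindAux (suc kmax ∸ k) k, which returns unknown exactly
  --  when k > kmax and otherwise unfolds as in the paper)
  module Kind (bc fc is : ℕ → List S) where
    kindAux : ℕ → ℕ → Result
    kindAux zero    k = unknown
    kindAux (suc n) k with bc k
    ... | π@(_ ∷ _) = seq π
    ... | [] with fc k
    ...   | [] = seq []
    ...   | _ ∷ _ with is k
    ...     | [] = seq []
    ...     | _ ∷ _ = kindAux n (suc k)

    kind : ℕ → ℕ → Result
    kind kmax k = kindAux (suc kmax ∸ k) k

-- A base-case witness is a prefix of an initial path ending in an error, i.e. a
-- counterexample. Reaching bound k means the base case failed at 1, …, k, so there is
-- no counterexample of length ≤ k; this is all that unknown certifies. If moreover the
-- forward condition fails, every initial path of length k ends in a completed state,
-- which only stutters, so a longer counterexample would already be erroneous at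
-- position k. If instead the inductive step fails, k consecutive safe states are always
-- followed by a safe one, so safety up to any n ≥ k extends to n + 1.
module Submission where

open import Defs
open import Data.Nat using (ℕ; zero; suc; _+_; _∸_; _≤_; _<_; z≤n; s≤s; _≤?_)
open import Data.Nat.Properties
  using (≤-refl; ≤-reflexive; ≤-trans; <⇒≤; ≰⇒>; suc-injective; +-identityʳ; +-suc;
         m≤m+n; m≤n+m; m∸[m∸n]≡n; m≤n⇒m⊓n≡m; m⊓n≤m; m≤n⇒m<n∨m≡n)
open import Data.List using (List; []; _∷_; take; drop; length; _++_; _∷ʳ_)
open import Data.List.Properties using (length-take; length-drop; take-all)
open import Data.List.Reverse using (Reverse; []; _∶_∶ʳ_; reverseView)
open import Data.List.Relation.Unary.All using (All; []; _∷_; sequenceM)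
open import Data.List.Relation.Unary.All.Properties using (drop⁺)
open import Data.List.Relation.Unary.Linked using (Linked; []; [-]; _∷_; tail)
open import Data.Product using (_×_; _,_; proj₁; proj₂)
open import Data.Sum using (inj₁; inj₂)
open import Data.Empty using (⊥-elim)
open import Data.Unit using (tt)
open import Relation.Nullary using (¬_; yes; no)
open import Relation.Nullary.Negation using (¬¬-Monad)
open import Relation.Binary.PropositionalEquality using (_≡_; refl; sym; trans; cong; subst)

module _ {A : Set} where

  length-∷ʳ : ∀ (xs : List A) {x} → length (xs ∷ʳ x) ≡ suc (length xs)
  length-∷ʳ []       = refl
  length-∷ʳ (_ ∷ xs) = cong suc (length-∷ʳ xs)

  take-length-++ : ∀ (xs : List A) {ys} → take (length xs) (xs ++ ys) ≡ xs
  take-length-++ []       = refl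
  take-length-++ (x ∷ xs) = cong (x ∷_) (take-length-++ xs)

  []≢∷ʳ : ∀ (xs : List A) {x} → ¬ ([] ≡ xs ∷ʳ x)
  []≢∷ʳ []      ()
  []≢∷ʳ (_ ∷ _) ()

module _ {A : Set} {R : A → A → Set} where

  Linked-take : ∀ n {xs} → Linked R xs → Linked R (take n xs)
  Linked-take zero          _        = []
  Linked-take (suc n)       []       = []
  Linked-take (suc zero)    [-]      = [-]
  Linked-take (suc (suc n)) [-]      = [-]
  Linked-take (suc zero)    (_ ∷ _)  = [-]
  Linked-take (suc (suc n)) (r ∷ rs) = r ∷ Linked-take (suc n) rs

  Linked-drop-++ : ∀ d xs {ys} → Linked R (xs ++ ys) → Linked R (drop d xs ++ ys)
  Linked-drop-++ zero    xs       rs = rs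
  Linked-drop-++ (suc d) []       rs = rs
  Linked-drop-++ (suc d) (_ ∷ xs) rs = Linked-drop-++ d xs (tail rs)

module _ (P : Program) where
  open Program P

  Last-∷ : ∀ {Q : S → Set} x xs → Last P Q xs → Last P Q (x ∷ xs)
  Last-∷ x (_ ∷ _) q = q

  Last-∷ʳ⁻ : ∀ {Q : S → Set} ys {t} → Last P Q (ys ∷ʳ t) → Q t
  Last-∷ʳ⁻ []           q = q
  Last-∷ʳ⁻ (_ ∷ [])     q = q
  Last-∷ʳ⁻ (_ ∷ y ∷ ys) q = Last-∷ʳ⁻ (y ∷ ys) q

  ¬Last⇒Last¬ : ∀ {Q : S → Set} x xs → ¬ Last P Q (x ∷ xs) → Last P (λ s → ¬ Q s) (x ∷ xs)
  ¬Last⇒Last¬ x []       ¬q = ¬q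
  ¬Last⇒Last¬ x (y ∷ ys) ¬q = ¬Last⇒Last¬ y ys ¬q

  All¬-take : ∀ {Q : S → Set} n xs → (∀ j → j < n → ¬ Last P Q (take (suc j) xs)) →
              All (λ s → ¬ Q s) (take n xs)
  All¬-take zero    xs       _ = []
  All¬-take (suc n) []       _ = []
  All¬-take (suc n) (x ∷ xs) h =
    h 0 (s≤s z≤n) ∷ All¬-take n xs (λ j j<n q → h (suc j) (s≤s j<n) (Last-∷ x (take (suc j) xs) q))

  InitPath-take : ∀ j xs → InitPath P xs → InitPath P (take (suc j) xs)
  InitPath-take j []       ((() , _) , _)
  InitPath-take j (x ∷ xs) ((_ , rs) , ini) = (tt , Linked-take (suc j) rs) , ini

  completed-stutters : ∀ {Q : S → Set} x ys → ψ x → Linked tr (x ∷ ys) → Last P Q (x ∷ ys) → Q x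
  completed-stutters x []       _  _        q = q
  completed-stutters x (y ∷ ys) ψx (r ∷ rs) q with proj₂ (proj₁ (ψ-stutter x) ψx) y r
  ... | refl = completed-stutters x ys ψx rs q

  Last-take-completed : ∀ {Q : S → Set} j xs → Linked tr xs → Last P ψ (take (suc j) xs) →
                        Last P Q xs → Last P Q (take (suc j) xs)
  Last-take-completed j       []           _        ()
  Last-take-completed zero    (x ∷ ys)     rs       ψx q = completed-stutters x ys ψx rs q
  Last-take-completed (suc j) (x ∷ [])     _        _  q = q
  Last-take-completed (suc j) (x ∷ y ∷ ys) (_ ∷ rs) ψl q = Last-take-completed j (y ∷ ys) rs ψl q

  SafeUpTo-zero : SafeUpTo P 0
  SafeUpTo-zero []      (((() , _) , _) , _)
  SafeUpTo-zero (_ ∷ _) _ ()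

  SafeUpTo-suc : ∀ {n} → SafeUpTo P n →
                 (∀ xs → Counterexample P xs → ¬ length xs ≡ suc n) → SafeUpTo P (suc n)
  SafeUpTo-suc safe new xs ce le with m≤n⇒m<n∨m≡n le
  ... | inj₁ (s≤s lt) = safe xs ce lt
  ... | inj₂ eq       = new xs ce eq

  Counterexample⇒BaseWitness : ∀ xs → Counterexample P xs → BaseWitness P (length xs) xs
  Counterexample⇒BaseWitness []           (((() , _) , _) , _)
  Counterexample⇒BaseWitness xs@(_ ∷ _) (ip , err) =
    xs , ip , refl , length xs , s≤s z≤n , ≤-refl , sym (take-all (length xs) xs ≤-refl) , err

  BaseWitness⇒Counterexample : ∀ {k} r → BaseWitness P k r → Counterexample P r
  BaseWitness⇒Counterexample r (p , ip , _ , suc i , _ , _ , refl , err) = InitPath-take i p ip , err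

  noBaseWitness⇒SafeUpTo-suc : ∀ {n} → SafeUpTo P n → (∀ r → ¬ BaseWitness P (suc n) r) →
                                SafeUpTo P (suc n)
  noBaseWitness⇒SafeUpTo-suc safe noB = SafeUpTo-suc safe λ xs ce eq →
    noB xs (subst (λ m → BaseWitness P m xs) eq (Counterexample⇒BaseWitness xs ce))

  noForwardWitness⇒safe : ∀ j → SafeUpTo P (suc j) → (∀ r → ¬ ForwardWitness P (suc j) r) →
                          IsSafe P
  noForwardWitness⇒safe j safe noF ([] , ((() , _) , _) , _)
  noForwardWitness⇒safe j safe noF (xs@(x ∷ xs′) , ce@(ip , err)) with length xs ≤? suc j
  ... | yes short = safe xs ce short
  ... | no long   = noF p (ip-p , length-p , ¬Last⇒Last¬ x (take j xs′) not-completed)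
    where
    p = take (suc j) xs
    ip-p : InitPath P p
    ip-p = InitPath-take j xs ip
    length-p : length p ≡ suc j
    length-p = trans (length-take (suc j) xs) (m≤n⇒m⊓n≡m (<⇒≤ (≰⇒> long)))
    not-completed : ¬ Last P ψ p
    not-completed ψp =
      safe p (ip-p , Last-take-completed j xs (proj₂ (proj₁ ip)) ψp err) (≤-reflexive length-p)

  SafeUpTo⇒¬¬φ-take : ∀ n xs → SafeUpTo P n → InitPath P xs → All (λ s → ¬ ¬ φ s) (take n xs)
  SafeUpTo⇒¬¬φ-take n xs safe ip = All¬-take n xs λ j j<n err →
    safe (take (suc j) xs) (InitPath-take j xs ip , err)
         (≤-trans (≤-reflexive (length-take (suc j) xs)) (≤-trans (m⊓n≤m (suc j) _) j<n))

  noInductiveWitness⇒¬¬φ : ∀ {k} → (∀ r → ¬ InductiveWitness P k r) →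
                           ∀ ys t → k ≤ length ys → SafeUpTo P (length ys) →
                           InitPath P (ys ∷ʳ t) → ¬ ¬ φ t
  -- φ need not be decidable, so safety up to length ys only yields ¬ ¬ φ on ys;
  -- this suffices because the goal is ⊥.
  noInductiveWitness⇒¬¬φ {k} noI ys t k≤ safe ip ¬φt =
    sequenceM _ ¬¬-Monad (drop⁺ d ¬¬φ-ys) λ φ-ts →
      noI (ts ∷ʳ t) (Linked-drop-++ d ys (proj₂ (proj₁ ip)) , ts , t , refl , length-ts , φ-ts , ¬φt)
    where
    d = length ys ∸ k
    ts = drop d ys
    length-ts : length ts ≡ k
    length-ts = trans (length-drop d ys) (m∸[m∸n]≡n k≤)
    ¬¬φ-ys : All (λ s → ¬ ¬ φ s) ys
    ¬¬φ-ys = subst (All _) (take-length-++ ys) (SafeUpTo⇒¬¬φ-take (length ys) (ys ∷ʳ t) safe ip)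

  noInductiveWitness⇒SafeUpTo-suc : ∀ {k n} → (∀ r → ¬ InductiveWitness P k r) → k ≤ n →
                                    SafeUpTo P n → SafeUpTo P (suc n)
  noInductiveWitness⇒SafeUpTo-suc {k} {n} noI k≤n safe =
    SafeUpTo-suc safe λ xs ce → no-counterexample (reverseView xs) ce
    where
    no-counterexample : ∀ {xs} → Reverse xs → Counterexample P xs → ¬ length xs ≡ suc n
    no-counterexample [] (((() , _) , _) , _)
    no-counterexample (ys ∶ _ ∶ʳ t) (ip , err) len =
      noInductiveWitness⇒¬¬φ noI ys t (subst (k ≤_) (sym n≡) k≤n) (subst (SafeUpTo P) (sym n≡) safe)
        ip (Last-∷ʳ⁻ ys err)
      where
      n≡ : length ys ≡ n
      n≡ = suc-injective (trans (sym (length-∷ʳ ys)) len)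

  noInductiveWitness⇒safe : ∀ {k} → SafeUpTo P k → (∀ r → ¬ InductiveWitness P k r) → IsSafe P
  noInductiveWitness⇒safe {k} safe noI (xs , ce) = SafeUpTo-beyond (length xs) xs ce (m≤m+n _ k)
    where
    SafeUpTo-beyond : ∀ m → SafeUpTo P (m + k)
    SafeUpTo-beyond zero    = safe
    SafeUpTo-beyond (suc m) = noInductiveWitness⇒SafeUpTo-suc noI (m≤n+m k m) (SafeUpTo-beyond m)

  Sound : ℕ → Result P → Set
  Sound K unknown        = SafeUpTo P K
  Sound K (seq [])       = IsSafe P
  Sound K (seq (x ∷ xs)) = Counterexample P (x ∷ xs)

  Sound⇒verdicts : ∀ {K} r → Sound K r →
    ((x : S) (xs : List S) → r ≡ seq (x ∷ xs) → Counterexample P (x ∷ xs) × HasCounterexample P)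
    × (r ≡ seq [] → IsSafe P)
    × (r ≡ unknown → SafeUpTo P K)
  Sound⇒verdicts unknown        s = (λ _ _ ()) , (λ ()) , λ _ → s
  Sound⇒verdicts (seq [])       s = (λ _ _ ()) , (λ _ → s) , λ ()
  Sound⇒verdicts (seq (x ∷ xs)) s = (λ { _ _ refl → s , x ∷ xs , s }) , (λ ()) , λ ()

  module _ (bc fc is : ℕ → List S)
           (base : CheckSpec P (BaseWitness P) bc)
           (forward : CheckSpec P (ForwardWitness P) fc)
           (step : CheckSpec P (InductiveWitness P) is) where
    open Kind P bc fc is

    kindAux-sound : ∀ n j → SafeUpTo P j → Sound (j + n) (kindAux n (suc j))
    kindAux-sound zero j safe = subst (SafeUpTo P) (sym (+-identityʳ j)) safe
    kindAux-sound (suc n) j safe with bc (suc j) | base (suc j) (s≤s z≤n)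
    ... | _ ∷ _ | inj₁ (() , _)
    ... | _ ∷ _ | inj₂ w = BaseWitness⇒Counterexample _ w
    ... | []    | inj₂ (_ , _ , _ , _ , _ , _ , _ , ())
    ... | []    | inj₁ (_ , noB) with fc (suc j) | forward (suc j) (s≤s z≤n)
    ...   | []    | inj₂ (((() , _) , _) , _)
    ...   | []    | inj₁ (_ , noF) = noForwardWitness⇒safe j (noBaseWitness⇒SafeUpTo-suc safe noB) noF
    ...   | _ ∷ _ | _ with is (suc j) | step (suc j) (s≤s z≤n)
    ...     | []    | inj₂ (_ , ts , _ , eq , _) = ⊥-elim ([]≢∷ʳ ts eq)
    ...     | []    | inj₁ (_ , noI) = noInductiveWitness⇒safe (noBaseWitness⇒SafeUpTo-suc safe noB) noI
    ...     | _ ∷ _ | _ = subst (λ K → Sound K (kindAux n (suc (suc j)))) (sym (+-suc j n))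
                            (kindAux-sound n (suc j) (noBaseWitness⇒SafeUpTo-suc safe noB))

theorem1 : (P : Program) (kmax : ℕ) → 1 ≤ kmax →
           (bc fc is : ℕ → List (Program.S P)) →
           CheckSpec P (BaseWitness P) bc →
           CheckSpec P (ForwardWitness P) fc →
           CheckSpec P (InductiveWitness P) is →
           ((x : Program.S P) (xs : List (Program.S P)) →
              Kind.kind P bc fc is kmax 1 ≡ seq (x ∷ xs) →
              Counterexample P (x ∷ xs) × HasCounterexample P)
           × (Kind.kind P bc fc is kmax 1 ≡ seq [] → IsSafe P)
           × (Kind.kind P bc fc is kmax 1 ≡ unknown → SafeUpTo P kmax)
-- kind kmax 1 reduces to kindAux kmax 1.
theorem1 P kmax _ bc fc is base forward step =
  Sound⇒verdicts P (Kind.kind P bc fc is kmax 1)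
    (kindAux-sound P bc fc is base forward step kmax 0 (SafeUpTo-zero P))
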